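{- Let $G$ be a $[4,2]$-graph of order $n$. Then $e(G)\ge \lfloor (n-1)^2/4\rfloor$. Moreover, if $n\ge 7$, equality holds if and only if $G$ is isomorphic to the disjoint union $K_{\lfloor n/2\rfloor}+K_{\lceil n/2\rceil}$ of two complete graphs.
   Context: All graphs are finite and simple. $e(G)$ denotes the number of edges of $G$. For a positive integer $s$ and a nonnegative integer $t$, a graph $G$ of order at least $s$ is called an $[s,t]$-graph if every induced subgraph of $G$ on $s$ vertices has at least $t$ edges. $K_m$ is the complete graph on $m$ vertices and $G+H$ denotes the vertex-disjoint union of $G$ and $H$. -}

module Defs where

open import Data.Nat using (ℕ; zero; suc; _+_; _*_; _∸_; _^_; _≤_; _<ᵇ_; _/_; ⌊_/2⌋)
open import Data.Bool using (Bool; true; false; if_then_else_; _∧_; not)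
open import Data.Fin using (Fin; toℕ)
open import Data.List using (List; map)
open import Data.Nat.ListAction using (sum)
open import Data.List using () renaming (allFin to allFinL)
open import Data.Product using (Σ; _×_)
open import Function.Bundles using (_↔_; Inverse)
open import Relation.Binary.PropositionalEquality using (_≡_)
open import Relation.Nullary using (¬_; yes; no)
open import Data.Empty using (⊥-elim)
open import Relation.Binary.PropositionalEquality using (refl)
import Relation.Binary.PropositionalEquality as ≡
open import Data.Fin.Properties using (_≟_)
open import Relation.Nullary.Decidable using (⌊_⌋)
open import Data.Bool.Properties using () renaming (_≟_ to _≟ᵇ_)

record Graph (n : ℕ) : Set where
  field
    adj   : Fin n → Fin n → Bool
    irrefl : ∀ i → adj i i ≡ false
    sym    : ∀ i j → adj i j ≡ adj j i
open Graph public

countEdges : (m : ℕ) → (Fin m → Fin m → Bool) → ℕ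
countEdges m a =
  sum (map (λ i → sum (map (λ j → if (toℕ i <ᵇ toℕ j) ∧ a i j then 1 else 0)
                           (allFinL m)))
           (allFinL m))

e : ∀ {n} → Graph n → ℕ
e {n} G = countEdges n (adj G)

-- An s-element vertex subset is given by an injection f : Fin s → Fin n;
-- the induced subgraph on its image has adjacency adj G (f a) (f b).
Injective : ∀ {s n} → (Fin s → Fin n) → Set
Injective f = ∀ a b → f a ≡ f b → a ≡ b

IsSTGraph : (s t : ℕ) → ∀ {n} → Graph n → Set
IsSTGraph s t {n} G =
  (s ≤ n) ×
  ((f : Fin s → Fin n) → Injective f →
     t ≤ countEdges s (λ a b → adj G (f a) (f b)))

_≅_ : ∀ {n} → Graph n → Graph n → Set
_≅_ {n} G H = Σ (Fin n ↔ Fin n) λ σ →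
  ∀ i j → adj G i j ≡ adj H (Inverse.to σ i) (Inverse.to σ j)

-- K_{⌊n/2⌋} + K_{⌈n/2⌉} on Fin n: the first ⌊n/2⌋ vertices form one clique,
-- the remaining ⌈n/2⌉ vertices form the other.
twoCliquesAdj : (n : ℕ) → Fin n → Fin n → Bool
twoCliquesAdj n i j =
  not ⌊ i ≟ j ⌋ ∧ ⌊ (toℕ i <ᵇ ⌊ n /2⌋) ≟ᵇ (toℕ j <ᵇ ⌊ n /2⌋) ⌋

private
  tcIrrefl : ∀ n i → twoCliquesAdj n i i ≡ false
  tcIrrefl n i with i ≟ i
  ... | yes _ = refl
  ... | no ¬p = ⊥-elim (¬p refl)

  tcSym : ∀ n i j → twoCliquesAdj n i j ≡ twoCliquesAdj n j i
  tcSym n i j with i ≟ j | j ≟ i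
  ... | yes _ | yes _ = refl
  ... | yes p | no q = ⊥-elim (q (≡.sym p))
  ... | no p | yes q = ⊥-elim (p (≡.sym q))
  ... | no _ | no _ with (toℕ i <ᵇ ⌊ n /2⌋) | (toℕ j <ᵇ ⌊ n /2⌋)
  ...   | true | true = refl
  ...   | true | false = refl
  ...   | false | true = refl
  ...   | false | false = refl

twoCliques : (n : ℕ) → Graph n
twoCliques n = record { adj = twoCliquesAdj n ; irrefl = tcIrrefl n ; sym = tcSym n }

-- A [4,2]-graph G is one whose complement N contains no diamond (K₄ minus an edge): two
-- triangles of N on a common edge would give four vertices spanning at most one edge of G.
-- Deleting a triangle of a diamond-free graph loses at most 3 + (n - 3) edges, since every
-- other vertex sees at most one of its corners; by induction e(N) ≤ n²/4 for n ≠ 3, and as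
-- e(G) + e(N) = C(n,2) this is e(G) ≥ ⌊(n-1)²/4⌋.  Equality means 4 e(N) ≥ n² - 1.  For n ≥ 7
-- the triangle count then leaves no room for a triangle in N, and the stability form of
-- Mantel's theorem applies: deleting an edge xy of a tight triangle-free graph, every other
-- vertex is adjacent to exactly one of x and y, and by induction the neighbourhoods of x and y
-- are the two halves of a balanced complete bipartite graph.  Its complement is
-- K⌊n/2⌋ + K⌈n/2⌉.

module Submission where

open import Defs
open import Data.Nat using (ℕ; _≤_; _∸_; _^_; _/_)
open import Data.Product using (_×_)
open import Relation.Binary.PropositionalEquality using (_≡_)
open import Function.Bundles using (_⇔_)

import Algebra.Properties.CommutativeMonoid.Sum as CommutativeMonoidSum
open import Data.Bool using (Bool; true; false; not; _∧_; _xor_; if_then_else_)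
open import Data.Bool.Properties
  using (not-involutive; not-injective; xor-same; xor-comm; ¬-not; ∧-identityʳ) renaming (_≟_ to _≟ᵇ_)
open import Data.Empty using (⊥; ⊥-elim)
open import Data.Fin using (Fin; zero; suc; toℕ; punchIn; fromℕ<)
open import Data.Fin.Permutation as Permutation using (Permutation′; _⟨$⟩ʳ_)
open import Data.Fin.Properties using (_≟_; toℕ-fromℕ<)
open import Data.List using (List; []; _∷_; _++_; map; length; tabulate; allFin)
open import Data.List.Membership.Propositional using (_∈_; find; lose)
open import Data.List.Membership.Propositional.Properties using (∈-∃++; ∈-allFin)
open import Data.List.Properties using (map-∘; map-tabulate; tabulate-cong; length-tabulate)
open import Data.List.Relation.Binary.Permutation.Propositional as Perm
  using (_↭_; ↭-sym; ↭-trans; ↭-prep; ↭⇒↭ₛ)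
open import Data.List.Relation.Binary.Permutation.Propositional.Properties
  using (∈-resp-↭; ↭-length; shift; map⁺)
import Data.List.Relation.Binary.Permutation.Setoid.Properties as Permutationₛ
open import Data.List.Relation.Unary.All as All using (All; []; _∷_)
open import Data.List.Relation.Unary.Any using (here; there; any?)
open import Data.List.Relation.Unary.Unique.Propositional using (Unique; []; _∷_)
open import Data.List.Relation.Unary.Unique.Propositional.Properties using (allFin⁺)
open import Data.Nat using (zero; suc; _+_; _*_; _<_; _<ᵇ_; z≤n; s≤s; NonZero; ⌊_/2⌋; ⌈_/2⌉)
open import Data.Nat.Combinatorics using (_C_; nC1≡n; nCk+nC[k+1]≡[n+1]C[k+1])
open import Data.Nat.DivMod using (m<n*o⇒m/o<n; m*n/n≡m; /-monoˡ-≤; m/n*n≤m)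
open import Data.Nat.Induction using (<-wellFounded)
open import Data.Nat.ListAction using (sum)
open import Data.Nat.ListAction.Properties using (sum-↭)
open import Data.Nat.Properties hiding (_≟_)
open import Data.Nat.Tactic.RingSolver using (solve-∀)
open import Data.Product as Product using (∃-syntax; Σ-syntax; _,_; proj₁; proj₂)
open import Data.Sum as Sum using (_⊎_; inj₁; inj₂; [_,_]′)
import Data.Vec as Vec
import Data.Vec.Relation.Unary.All as AllVec
import Data.Vec.Relation.Unary.AllPairs as AllPairsVec
import Data.Vec.Relation.Unary.Unique.Propositional as UniqueVec
open import Data.Vec.Relation.Unary.Unique.Propositional.Properties using (lookup-injective)
open import Function using (_∘_; id)
open import Function.Bundles using (mk⇔; Equivalence; Injection)
open import Function.Properties.Inverse using (↔⇒↣)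
open import Function.Properties.Equivalence using () renaming (trans to ⇔-trans; sym to ⇔-sym)
open import Induction.WellFounded using (Acc; acc)
open import Relation.Binary.PropositionalEquality as ≡ using (_≢_; refl; cong; cong₂; subst; subst₂)
open import Relation.Nullary using (¬_; Dec; yes; no)
open import Relation.Nullary.Decidable as Decidable using (⌊_⌋; _×-dec_; dec-true; dec-false; isYes≗does)

open import Algebra.Properties.CommutativeSemigroup +-commutativeSemigroup
  using () renaming (interchange to +-interchange)
module Σℕ = CommutativeMonoidSum +-0-commutativeMonoid

-- Arithmetic of the inductive steps

quadrupled-bound : ∀ c {m S E} → S ≤ m → 4 * E ≤ m * m → 4 * (c + S + E) ≤ 4 * (c + m) + m * m
quadrupled-bound c {m} {S} {E} S≤m 4E≤m² = begin
  4 * (c + S + E)        ≡⟨ *-distribˡ-+ 4 (c + S) E ⟩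
  4 * (c + S) + 4 * E    ≤⟨ +-mono-≤ (*-monoʳ-≤ 4 (+-monoʳ-≤ c S≤m)) 4E≤m² ⟩
  4 * (c + m) + m * m    ∎
  where open ≤-Reasoning

mantel-step : ∀ {m S E} → S ≤ m → 4 * E ≤ m * m → 4 * (1 + S + E) ≤ (2 + m) * (2 + m)
mantel-step {m} S≤m 4E≤m² = ≤-trans (quadrupled-bound 1 S≤m 4E≤m²) (≤-reflexive (square m))
  where
  square : ∀ m → 4 * (1 + m) + m * m ≡ (2 + m) * (2 + m)
  square = solve-∀

mantel-step-tight : ∀ {m S E} → S ≤ m → 4 * E ≤ m * m → (2 + m) * (2 + m) ≤ 1 + 4 * (1 + S + E) →
                    m ≤ S × m * m ≤ 1 + 4 * E
mantel-step-tight {m} {S} {E} S≤m 4E≤m² tight = m≤S , +-cancelˡ-≤ (4 + 4 * m) _ _ (begin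
    4 + 4 * m + m * m       ≡⟨ expand m ⟩
    (2 + m) * (2 + m)       ≤⟨ tight ⟩
    1 + 4 * (1 + S + E)     ≤⟨ +-monoʳ-≤ 1 (*-monoʳ-≤ 4 (+-monoˡ-≤ E (+-monoʳ-≤ 1 S≤m))) ⟩
    1 + 4 * (1 + m + E)     ≡⟨ regroup m E ⟩
    4 + 4 * m + (1 + 4 * E) ∎)
  where
  open ≤-Reasoning
  expand : ∀ m → 4 + 4 * m + m * m ≡ (2 + m) * (2 + m)
  expand = solve-∀
  regroup : ∀ m E → 1 + 4 * (1 + m + E) ≡ 4 + 4 * m + (1 + 4 * E)
  regroup = solve-∀
  m≤S : m ≤ S
  m≤S with m ≤? S
  ... | yes m≤S = m≤S
  ... | no m≰S = ⊥-elim (<-irrefl refl (begin-strict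
    (2 + m) * (2 + m)            ≤⟨ tight ⟩
    1 + 4 * (1 + S + E)          ≡⟨ cong (1 +_) (*-distribˡ-+ 4 (1 + S) E) ⟩
    1 + (4 * (1 + S) + 4 * E)    ≤⟨ +-monoʳ-≤ 1 (+-mono-≤ (*-monoʳ-≤ 4 (≰⇒> m≰S)) 4E≤m²) ⟩
    1 + (4 * m + m * m)          <⟨ +-monoˡ-< (4 * m + m * m) {1} {4} (s≤s (s≤s z≤n)) ⟩
    4 + (4 * m + m * m)          ≡⟨ +-assoc 4 (4 * m) (m * m) ⟨
    4 + 4 * m + m * m            ≡⟨ expand m ⟩
    (2 + m) * (2 + m)            ∎))

diamond-step : ∀ m {S E} → S ≤ m → 4 * E ≤ m * m ⊎ (m ≡ 3 × E ≤ 3) →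
               4 * (3 + S + E) ≤ (3 + m) * (3 + m) ⊎ (3 + m ≡ 3 × 3 + S + E ≤ 3)
diamond-step 0 {E = 0} z≤n (inj₁ _) = inj₂ (refl , ≤-refl)
diamond-step 1 {E = 0} S≤1 (inj₁ _) = inj₁ (*-monoʳ-≤ 4 (+-monoˡ-≤ 0 (+-monoʳ-≤ 3 S≤1)))
diamond-step 3 S≤3 (inj₂ (_ , E≤3)) = inj₁ (*-monoʳ-≤ 4 (+-mono-≤ (+-monoʳ-≤ 3 S≤3) E≤3))
diamond-step (suc (suc k)) {S} {E} S≤m (inj₁ 4E≤m²) = inj₁ (begin
  4 * (3 + S + E)                                        ≤⟨ quadrupled-bound 3 S≤m 4E≤m² ⟩
  4 * (3 + (2 + k)) + (2 + k) * (2 + k)                  ≤⟨ m≤m+n _ (1 + 2 * k) ⟩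
  4 * (3 + (2 + k)) + (2 + k) * (2 + k) + (1 + 2 * k)    ≡⟨ square k ⟩
  (3 + (2 + k)) * (3 + (2 + k))                          ∎)
  where
  open ≤-Reasoning
  square : ∀ k → 4 * (3 + (2 + k)) + (2 + k) * (2 + k) + (1 + 2 * k) ≡ (3 + (2 + k)) * (3 + (2 + k))
  square = solve-∀
diamond-step 0 {E = suc _} _ (inj₁ ())
diamond-step 1 {E = suc e} _ (inj₁ E-small) = ⊥-elim (¬4≤1 (≤-trans (m≤m*n 4 (suc e)) E-small))
  where
  ¬4≤1 : ¬ 4 ≤ 1
  ¬4≤1 (s≤s ())
diamond-step 0 _ (inj₂ (() , _))
diamond-step 1 _ (inj₂ (() , _))
diamond-step 2 _ (inj₂ (() , _))
diamond-step (suc (suc (suc (suc _)))) _ (inj₂ (() , _))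

triangle-excess : ∀ {m S E} → 4 ≤ m → S ≤ m → 4 * E ≤ m * m →
                  2 + 4 * (3 + S + E) ≤ (3 + m) * (3 + m)
triangle-excess {.(4 + k)} {S} {E} (s≤s (s≤s (s≤s (s≤s {n = k} z≤n)))) S≤m 4E≤m² = begin
  2 + 4 * (3 + S + E)                                        ≤⟨ +-monoʳ-≤ 2 (quadrupled-bound 3 S≤m 4E≤m²) ⟩
  2 + (4 * (3 + (4 + k)) + (4 + k) * (4 + k))                ≤⟨ m≤m+n _ (3 + 2 * k) ⟩
  2 + (4 * (3 + (4 + k)) + (4 + k) * (4 + k)) + (3 + 2 * k)  ≡⟨ square k ⟩
  (3 + (4 + k)) * (3 + (4 + k))                              ∎
  where
  open ≤-Reasoning
  square : ∀ k → 2 + (4 * (3 + (4 + k)) + (4 + k) * (4 + k)) + (3 + 2 * k) ≡ (3 + (4 + k)) * (3 + (4 + k))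
  square = solve-∀

/-unique : ∀ {X q} d .{{_ : NonZero d}} → q * d ≤ X → X < suc q * d → X / d ≡ q
/-unique {X} {q} d qd≤X X<[1+q]d = ≤-antisym
  (≤-pred (m<n*o⇒m/o<n X<[1+q]d))
  (≤-trans (≤-reflexive (≡.sym (m*n/n≡m q d))) (/-monoˡ-≤ d qd≤X))

-- Instantiated with E = e(G), N = e(complement G), Y = n² and X = (n-1)².
module QuarterFloor (E N X Y : ℕ) (total : 4 * E + 4 * N + 1 ≡ Y + X) (4N≤Y : 4 * N ≤ Y) where

  private
    X<[1+E]*4 : X < suc E * 4
    X<[1+E]*4 = +-cancelˡ-≤ Y (suc X) (suc E * 4) (begin
      Y + suc X                ≡⟨ +-suc Y X ⟩
      suc (Y + X)              ≡⟨ cong suc total ⟨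
      suc (4 * E + 4 * N + 1)  ≡⟨ regroup E N ⟩
      4 * N + (E * 4 + 2)      ≤⟨ +-mono-≤ 4N≤Y (+-monoʳ-≤ (E * 4) (s≤s (s≤s (z≤n {2})))) ⟩
      Y + (E * 4 + 4)          ≡⟨ cong (Y +_) (+-comm (E * 4) 4) ⟩
      Y + suc E * 4            ∎)
      where
      open ≤-Reasoning
      regroup : ∀ E N → suc (4 * E + 4 * N + 1) ≡ 4 * N + (E * 4 + 2)
      regroup = solve-∀

  X/4≤E : X / 4 ≤ E
  X/4≤E = ≤-pred (m<n*o⇒m/o<n X<[1+E]*4)

  E≡X/4⇔Y≤1+4N : (E ≡ X / 4) ⇔ (Y ≤ 1 + 4 * N)
  E≡X/4⇔Y≤1+4N = mk⇔ to from
    where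
    open ≤-Reasoning
    to : E ≡ X / 4 → Y ≤ 1 + 4 * N
    to E≡X/4 = +-cancelʳ-≤ X Y (1 + 4 * N) (begin
      Y + X              ≡⟨ total ⟨
      4 * E + 4 * N + 1  ≡⟨ regroup E N ⟩
      1 + 4 * N + E * 4  ≤⟨ +-monoʳ-≤ (1 + 4 * N) E*4≤X ⟩
      1 + 4 * N + X      ∎)
      where
      E*4≤X : E * 4 ≤ X
      E*4≤X = ≤-trans (≤-reflexive (cong (_* 4) E≡X/4)) (m/n*n≤m X 4)
      regroup : ∀ E N → 4 * E + 4 * N + 1 ≡ 1 + 4 * N + E * 4
      regroup = solve-∀
    from : Y ≤ 1 + 4 * N → E ≡ X / 4
    from Y≤1+4N = ≡.sym (/-unique 4 (+-cancelˡ-≤ Y (E * 4) X (begin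
      Y + E * 4          ≤⟨ +-monoˡ-≤ (E * 4) Y≤1+4N ⟩
      1 + 4 * N + E * 4  ≡⟨ regroup E N ⟩
      4 * E + 4 * N + 1  ≡⟨ total ⟩
      Y + X              ∎)) X<[1+E]*4)
      where
      regroup : ∀ E N → 1 + 4 * N + E * 4 ≡ 4 * E + 4 * N + 1
      regroup = solve-∀

[1+n]C2≡n+nC2 : ∀ n → suc n C 2 ≡ n + n C 2
[1+n]C2≡n+nC2 n = ≡.trans (≡.sym (nCk+nC[k+1]≡[n+1]C[k+1] n 1)) (cong (_+ n C 2) (nC1≡n n))

four-pairs : ∀ k → 4 * (suc k C 2) + 1 ≡ suc k * suc k + k ^ 2
four-pairs zero = refl
four-pairs (suc k) = begin
  4 * (suc (suc k) C 2) + 1          ≡⟨ cong (λ c → 4 * c + 1) ([1+n]C2≡n+nC2 (suc k)) ⟩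
  4 * (suc k + suc k C 2) + 1        ≡⟨ regroup (suc k) (suc k C 2) ⟩
  4 * suc k + (4 * (suc k C 2) + 1)  ≡⟨ cong (4 * suc k +_) (four-pairs k) ⟩
  4 * suc k + (suc k * suc k + k ^ 2) ≡⟨ square k ⟩
  suc (suc k) * suc (suc k) + suc k ^ 2 ∎
  where
  open ≡.≡-Reasoning
  regroup : ∀ a c → 4 * (a + c) + 1 ≡ 4 * a + (4 * c + 1)
  regroup = solve-∀
  square : ∀ k → 4 * (1 + k) + ((1 + k) * (1 + k) + k * (k * 1)) ≡
                 (2 + k) * (2 + k) + (1 + k) * ((1 + k) * 1)
  square = solve-∀

square≤1+4⌊n/2⌋⌈n/2⌉ : ∀ n → n * n ≤ 1 + 4 * (⌊ n /2⌋ * ⌈ n /2⌉)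
square≤1+4⌊n/2⌋⌈n/2⌉ 0 = z≤n
square≤1+4⌊n/2⌋⌈n/2⌉ 1 = ≤-refl
square≤1+4⌊n/2⌋⌈n/2⌉ (suc (suc m)) = begin
  (2 + m) * (2 + m)                   ≡⟨ expand m ⟩
  m * m + 4 * m + 4                   ≤⟨ +-monoˡ-≤ 4 (+-monoˡ-≤ (4 * m) (square≤1+4⌊n/2⌋⌈n/2⌉ m)) ⟩
  1 + 4 * (a * b) + 4 * m + 4         ≡⟨ cong (λ m → 1 + 4 * (a * b) + 4 * m + 4) (⌊n/2⌋+⌈n/2⌉≡n m) ⟨
  1 + 4 * (a * b) + 4 * (a + b) + 4   ≡⟨ regroup a b ⟩
  1 + 4 * (suc a * suc b)             ∎
  where
  open ≤-Reasoning
  a = ⌊ m /2⌋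
  b = ⌈ m /2⌉
  expand : ∀ m → (2 + m) * (2 + m) ≡ m * m + 4 * m + 4
  expand = solve-∀
  regroup : ∀ a b → 1 + 4 * (a * b) + 4 * (a + b) + 4 ≡ 1 + 4 * ((1 + a) * (1 + b))
  regroup = solve-∀

module _ {t f n : ℕ} (t+f≡n : t + f ≡ n) where

  ⌊n/2⌋-complement : t ≡ ⌊ n /2⌋ → f ≡ ⌈ n /2⌉
  ⌊n/2⌋-complement t≡ = +-cancelˡ-≡ t f ⌈ n /2⌉
    (≡.trans t+f≡n (≡.trans (≡.sym (⌊n/2⌋+⌈n/2⌉≡n n)) (cong (_+ ⌈ n /2⌉) (≡.sym t≡))))

  ⌊n/2⌋-split-positive : 2 ≤ n → t ≡ ⌊ n /2⌋ → 0 < t × 0 < f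
  ⌊n/2⌋-split-positive 2≤n t≡ = 0<t , ≤-trans 0<t (≤-trans (≤-reflexive t≡)
      (≤-trans (⌊n/2⌋≤⌈n/2⌉ n) (≤-reflexive (≡.sym (⌊n/2⌋-complement t≡)))))
    where
    0<t : 0 < t
    0<t = ≤-trans (⌊n/2⌋-mono 2≤n) (≤-reflexive (≡.sym t≡))

iverson : Bool → ℕ
iverson b = if b then 1 else 0

iverson-≤1 : ∀ b → iverson b ≤ 1
iverson-≤1 true = ≤-refl
iverson-≤1 false = z≤n

iverson-+-iverson-not : ∀ b → iverson b + iverson (not b) ≡ 1
iverson-+-iverson-not true = refl
iverson-+-iverson-not false = refl

iverson-+-≡1 : ∀ {a b} → b ≡ not a → iverson a + iverson b ≡ 1
iverson-+-≡1 {a} refl = iverson-+-iverson-not a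

iverson-+-≤1 : ∀ a b → (a ≡ true → b ≡ true → ⊥) → iverson a + iverson b ≤ 1
iverson-+-≤1 true  true  ¬ab = ⊥-elim (¬ab refl refl)
iverson-+-≤1 true  false _   = ≤-refl
iverson-+-≤1 false b     _   = iverson-≤1 b

iverson-+-+-≤1 : ∀ a b c → (a ≡ true → b ≡ true → ⊥) → (a ≡ true → c ≡ true → ⊥) →
                 (b ≡ true → c ≡ true → ⊥) → iverson a + iverson b + iverson c ≤ 1
iverson-+-+-≤1 true  true  _     ¬ab _   _   = ⊥-elim (¬ab refl refl)
iverson-+-+-≤1 true  false true  _   ¬ac _   = ⊥-elim (¬ac refl refl)
iverson-+-+-≤1 true  false false _   _   _   = ≤-refl
iverson-+-+-≤1 false b     c     _   _   ¬bc = iverson-+-≤1 b c ¬bc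

xor-shift : ∀ a b c d → a xor b ≡ c xor d → d ≡ (c xor a) xor b
xor-shift false b false d eq = ≡.sym eq
xor-shift false b true  d eq = ≡.trans (≡.sym (not-involutive d)) (cong not (≡.sym eq))
xor-shift true  b false d eq = ≡.sym eq
xor-shift true  b true  d eq = not-injective (≡.sym eq)

xor≡false⇒≡ : ∀ a b → a xor b ≡ false → b ≡ a
xor≡false⇒≡ false b eq = eq
xor≡false⇒≡ true  b eq = ≡.trans (≡.sym (not-involutive b)) (cong not eq)

not-xor-self : ∀ a → not a xor a ≡ true
not-xor-self false = refl
not-xor-self true  = refl

not-xor-not : ∀ a b → not a xor not b ≡ a xor b
not-xor-not false b = not-involutive b
not-xor-not true  b = refl

⌊≟ᵇ⌋≡not-xor : ∀ a b → ⌊ a ≟ᵇ b ⌋ ≡ not (a xor b)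
⌊≟ᵇ⌋≡not-xor false false = refl
⌊≟ᵇ⌋≡not-xor false true  = refl
⌊≟ᵇ⌋≡not-xor true  false = refl
⌊≟ᵇ⌋≡not-xor true  true  = refl

count : {A : Set} → (A → Bool) → List A → ℕ
count p L = sum (map (iverson ∘ p) L)

module _ {A : Set} where

  sum-map-+ : ∀ (f g : A → ℕ) L → sum (map (λ v → f v + g v) L) ≡ sum (map f L) + sum (map g L)
  sum-map-+ f g [] = refl
  sum-map-+ f g (x ∷ L) = ≡.trans (cong (f x + g x +_) (sum-map-+ f g L)) (+-interchange (f x) (g x) _ _)

  sum-map-cong-∈ : ∀ {f g : A → ℕ} L → (∀ {v} → v ∈ L → f v ≡ g v) → sum (map f L) ≡ sum (map g L)
  sum-map-cong-∈ [] f≡g = refl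
  sum-map-cong-∈ (x ∷ L) f≡g = cong₂ _+_ (f≡g (here refl)) (sum-map-cong-∈ L (f≡g ∘ there))

  sum-map-≤-length : ∀ {f : A → ℕ} L → (∀ {v} → v ∈ L → f v ≤ 1) → sum (map f L) ≤ length L
  sum-map-≤-length [] f≤1 = z≤n
  sum-map-≤-length (x ∷ L) f≤1 = +-mono-≤ (f≤1 (here refl)) (sum-map-≤-length L (f≤1 ∘ there))

  sum-map-≥-length⇒≡1 : ∀ {f : A → ℕ} L → (∀ {v} → v ∈ L → f v ≤ 1) →
                         length L ≤ sum (map f L) → ∀ {v} → v ∈ L → f v ≡ 1
  sum-map-≥-length⇒≡1 {f} (x ∷ L) f≤1 L≤Σ (here refl) =
    ≤-antisym (f≤1 (here refl))
      (+-cancelʳ-≤ (length L) 1 (f x) (≤-trans L≤Σ (+-monoʳ-≤ (f x) (sum-map-≤-length L (f≤1 ∘ there)))))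
  sum-map-≥-length⇒≡1 {f} (x ∷ L) f≤1 L≤Σ (there v∈) =
    sum-map-≥-length⇒≡1 L (f≤1 ∘ there)
      (+-cancelˡ-≤ 1 _ _ (≤-trans L≤Σ (+-monoˡ-≤ _ (f≤1 (here refl))))) v∈

  sum-map-↭ : ∀ (f : A → ℕ) {L L′} → L ↭ L′ → sum (map f L) ≡ sum (map f L′)
  sum-map-↭ f L↭L′ = sum-↭ (map⁺ f L↭L′)

count-+-count-not : ∀ {A : Set} (p : A → Bool) L → count p L + count (not ∘ p) L ≡ length L
count-+-count-not p [] = refl
count-+-count-not p (x ∷ L) = ≡.trans (+-interchange (iverson (p x)) _ (iverson (not (p x))) _)
  (cong₂ _+_ (iverson-+-iverson-not (p x)) (count-+-count-not p L))

count≤length : ∀ {A : Set} (p : A → Bool) L → count p L ≤ length L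
count≤length p L = sum-map-≤-length L (λ {v} _ → iverson-≤1 (p v))

count≡0⊎∃ : ∀ {A : Set} (p : A → Bool) L → count p L ≡ 0 ⊎ ∃[ v ] v ∈ L × p v ≡ true
count≡0⊎∃ p [] = inj₁ refl
count≡0⊎∃ p (x ∷ L) with p x in px | count≡0⊎∃ p L
... | true  | _                  = inj₂ (x , here refl , px)
... | false | inj₁ c≡0           = inj₁ c≡0
... | false | inj₂ (v , v∈ , pv) = inj₂ (v , there v∈ , pv)

count>0⇒∃ : ∀ {A : Set} (p : A → Bool) L → 0 < count p L → ∃[ v ] v ∈ L × p v ≡ true
count>0⇒∃ p L 0<c with count≡0⊎∃ p L
... | inj₁ c≡0 = ⊥-elim (<-irrefl (≡.sym c≡0) 0<c)
... | inj₂ w   = w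

module _ {A : Set} where

  ∈⇒↭∷ : ∀ {x : A} {L} → x ∈ L → ∃[ L′ ] L ↭ x ∷ L′
  ∈⇒↭∷ {x} x∈ with ys , zs , refl ← ∈-∃++ x∈ = ys ++ zs , shift x ys zs

  distinct-∈⇒↭∷∷ : ∀ {x y : A} {L} → x ∈ L → y ∈ L → x ≢ y → ∃[ L′ ] L ↭ x ∷ y ∷ L′
  distinct-∈⇒↭∷∷ {x} x∈ y∈ x≢y with L₁ , L↭ ← ∈⇒↭∷ x∈ with ∈-resp-↭ L↭ y∈
  ... | here y≡x = ⊥-elim (x≢y (≡.sym y≡x))
  ... | there y∈L₁ with L₂ , L₁↭ ← ∈⇒↭∷ y∈L₁ = L₂ , ↭-trans L↭ (↭-prep x L₁↭)

  distinct-∈⇒2≤length : ∀ {x y : A} {L} → x ∈ L → y ∈ L → x ≢ y → 2 ≤ length L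
  distinct-∈⇒2≤length x∈ y∈ x≢y with L′ , L↭ ← distinct-∈⇒↭∷∷ x∈ y∈ x≢y =
    ≤-trans (s≤s (s≤s z≤n)) (≤-reflexive (≡.sym (↭-length L↭)))

  Unique-resp-↭ : ∀ {L L′ : List A} → L ↭ L′ → Unique L → Unique L′
  Unique-resp-↭ L↭ = Permutationₛ.Unique-resp-↭ (≡.setoid A) (↭⇒↭ₛ L↭)

  count-↭ : ∀ (p : A → Bool) {L L′} → L ↭ L′ → count p L ≡ count p L′
  count-↭ p = sum-map-↭ (iverson ∘ p)

  ↭-⊆ : ∀ {v : A} {L L′} → L ↭ L′ → v ∈ L′ → v ∈ L
  ↭-⊆ L↭ = ∈-resp-↭ (↭-sym L↭)

  ↭∷⇒shorter : ∀ {x : A} {L L′} → L ↭ x ∷ L′ → length L′ < length L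
  ↭∷⇒shorter L↭ = ≤-reflexive (≡.sym (↭-length L↭))

  ∃∈? : {P : A → Set} → (∀ x → Dec (P x)) → ∀ L → Dec (∃[ x ] x ∈ L × P x)
  ∃∈? P? L = Decidable.map′ find (λ (_ , x∈ , px) → lose x∈ px) (any? P? L)

Balanced : {A : Set} → (A → Bool) → List A → Set
Balanced c L = count c L ≡ ⌊ length L /2⌋ ⊎ count (not ∘ c) L ≡ ⌊ length L /2⌋

module _ {A : Set} {c : A → Bool} where

  Balanced-↭ : ∀ {L L′} → L ↭ L′ → Balanced c L′ → Balanced c L
  Balanced-↭ {L} {L′} L↭ = Sum.map (transport c) (transport (not ∘ c))
    where
    transport : ∀ p → count p L′ ≡ ⌊ length L′ /2⌋ → count p L ≡ ⌊ length L /2⌋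
    transport p eq = ≡.trans (count-↭ p L↭) (≡.trans eq (cong ⌊_/2⌋ (≡.sym (↭-length L↭))))

  Balanced-cong : ∀ {d : A → Bool} {L} → (∀ {v} → v ∈ L → d v ≡ c v) → Balanced c L → Balanced d L
  Balanced-cong {L = L} d≡c = Sum.map (≡.trans (sum-map-cong-∈ L (cong iverson ∘ d≡c)))
                                      (≡.trans (sum-map-cong-∈ L (cong (iverson ∘ not) ∘ d≡c)))

  Balanced-not : ∀ {L} → Balanced c L → Balanced (not ∘ c) L
  Balanced-not {L} = [ inj₂ ∘ ≡.trans not-not , inj₁ ]′
    where
    not-not : count (not ∘ not ∘ c) L ≡ count c L
    not-not = sum-map-cong-∈ L (λ {v} _ → cong iverson (not-involutive (c v)))

  Balanced-∷∷ : ∀ {x y L} → c y ≡ not (c x) → Balanced c L → Balanced c (x ∷ y ∷ L)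
  Balanced-∷∷ {x} {y} {L} cy = Sum.map (≡.trans (step (iverson-+-≡1 cy)) ∘ cong suc)
                                        (≡.trans (step (iverson-+-≡1 (cong not cy))) ∘ cong suc)
    where
    step : ∀ {p : A → Bool} → iverson (p x) + iverson (p y) ≡ 1 → count p (x ∷ y ∷ L) ≡ 1 + count p L
    step {p} one = ≡.trans (≡.sym (+-assoc (iverson (p x)) _ _)) (cong (_+ count p L) one)

  Balanced⇒counts-positive : ∀ {L} → 2 ≤ length L → Balanced c L → 0 < count c L × 0 < count (not ∘ c) L
  Balanced⇒counts-positive {L} 2≤n (inj₁ t≡) = ⌊n/2⌋-split-positive (count-+-count-not c L) 2≤n t≡
  Balanced⇒counts-positive {L} 2≤n (inj₂ f≡) =
    Product.swap (⌊n/2⌋-split-positive (≡.trans (+-comm (count (not ∘ c) L) _) (count-+-count-not c L))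
                                       2≤n f≡)

  Balanced⇒both-colours : ∀ {L} → 2 ≤ length L → Balanced c L → ∀ b → ∃[ u ] u ∈ L × c u ≡ b
  Balanced⇒both-colours {L} 2≤n bal true = count>0⇒∃ c L (proj₁ (Balanced⇒counts-positive {L} 2≤n bal))
  Balanced⇒both-colours {L} 2≤n bal false
    with u , u∈ , ¬cu ← count>0⇒∃ (not ∘ c) L (proj₂ (Balanced⇒counts-positive {L} 2≤n bal)) =
    u , u∈ , ≡.trans (≡.sym (not-involutive (c u))) (cong not ¬cu)

module _ {V : Set} (H : V → V → Bool) where

  degree : V → List V → ℕ
  degree x = count (H x)

  edgesIn : List V → ℕ
  edgesIn [] = 0
  edgesIn (x ∷ L) = degree x L + edgesIn L

  edgesIn≡0⊎edge : ∀ L → edgesIn L ≡ 0 ⊎ ∃[ x ] ∃[ y ] x ∈ L × y ∈ L × H x y ≡ true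
  edgesIn≡0⊎edge [] = inj₁ refl
  edgesIn≡0⊎edge (x ∷ L) with count≡0⊎∃ (H x) L | edgesIn≡0⊎edge L
  ... | inj₂ (y , y∈ , xy) | _                             = inj₂ (x , y , here refl , there y∈ , xy)
  ... | inj₁ _             | inj₂ (u , v , u∈ , v∈ , uv)   = inj₂ (u , v , there u∈ , there v∈ , uv)
  ... | inj₁ d≡0           | inj₁ E≡0                      = inj₁ (cong₂ _+_ d≡0 E≡0)

  edgesIn-∷∷ : ∀ x y L → edgesIn (x ∷ y ∷ L) ≡ iverson (H x y) + (degree x L + degree y L) + edgesIn L
  edgesIn-∷∷ x y L = begin
    (iverson (H x y) + degree x L) + (degree y L + edgesIn L)  ≡⟨ +-assoc (iverson (H x y)) _ _ ⟩
    iverson (H x y) + (degree x L + (degree y L + edgesIn L))  ≡⟨ cong (iverson (H x y) +_) (+-assoc (degree x L) _ _) ⟨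
    iverson (H x y) + ((degree x L + degree y L) + edgesIn L)  ≡⟨ +-assoc (iverson (H x y)) _ _ ⟨
    iverson (H x y) + (degree x L + degree y L) + edgesIn L    ∎
    where open ≡.≡-Reasoning

edgesIn-map : ∀ {A V : Set} (H : V → V → Bool) (g : A → V) L →
              edgesIn H (map g L) ≡ edgesIn (λ i j → H (g i) (g j)) L
edgesIn-map H g [] = refl
edgesIn-map H g (x ∷ L) = cong₂ _+_ (cong sum (≡.sym (map-∘ L))) (edgesIn-map H g L)

edgesIn-complementary : ∀ {V : Set} (H H′ : V → V → Bool) L → Unique L →
                        (∀ {x y} → x ≢ y → H′ x y ≡ not (H x y)) → edgesIn H L + edgesIn H′ L ≡ length L C 2
edgesIn-complementary H H′ [] _ _ = refl
edgesIn-complementary H H′ (x ∷ L) (x≢ ∷ u) H′≡¬H = begin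
  (degree H x L + edgesIn H L) + (degree H′ x L + edgesIn H′ L)
    ≡⟨ +-interchange (degree H x L) _ _ _ ⟩
  (degree H x L + degree H′ x L) + (edgesIn H L + edgesIn H′ L)
    ≡⟨ cong₂ _+_ degrees (edgesIn-complementary H H′ L u H′≡¬H) ⟩
  length L + length L C 2
    ≡⟨ [1+n]C2≡n+nC2 (length L) ⟨
  suc (length L) C 2
    ∎
  where
  open ≡.≡-Reasoning
  degrees : degree H x L + degree H′ x L ≡ length L
  degrees = ≡.trans (cong (degree H x L +_) (sum-map-cong-∈ L (cong iverson ∘ H′≡¬H ∘ All.lookup x≢)))
                    (count-+-count-not (H x) L)

-- Mantel's theorem, its stability version, and diamond-free graphs

module SimpleGraph {V : Set} (H : V → V → Bool)
                   (H-sym : ∀ x y → H x y ≡ H y x) (H-irrefl : ∀ x → H x x ≡ false) where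

  adjacent⇒≢ : ∀ {x y} → H x y ≡ true → x ≢ y
  adjacent⇒≢ {x} xy refl with () ← ≡.trans (≡.sym xy) (H-irrefl x)

  edgesIn-↭ : ∀ {L L′} → L ↭ L′ → edgesIn H L ≡ edgesIn H L′
  edgesIn-↭ Perm.refl = refl
  edgesIn-↭ (Perm.prep x L↭) = cong₂ _+_ (count-↭ (H x) L↭) (edgesIn-↭ L↭)
  edgesIn-↭ (Perm.swap {L} {L′} x y L↭) = begin
    edgesIn H (x ∷ y ∷ L)
      ≡⟨ edgesIn-∷∷ H x y L ⟩
    iverson (H x y) + (degree H x L + degree H y L) + edgesIn H L
      ≡⟨ cong (_+ edgesIn H L) (cong₂ _+_ (cong iverson (H-sym x y)) (+-comm (degree H x L) _)) ⟩
    iverson (H y x) + (degree H y L + degree H x L) + edgesIn H L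
      ≡⟨ cong₂ (λ d E → iverson (H y x) + d + E)
               (cong₂ _+_ (count-↭ (H y) L↭) (count-↭ (H x) L↭)) (edgesIn-↭ L↭) ⟩
    iverson (H y x) + (degree H y L′ + degree H x L′) + edgesIn H L′
      ≡⟨ edgesIn-∷∷ H y x L′ ⟨
    edgesIn H (y ∷ x ∷ L′)
      ∎
    where open ≡.≡-Reasoning
  edgesIn-↭ (Perm.trans L↭ L↭′) = ≡.trans (edgesIn-↭ L↭) (edgesIn-↭ L↭′)

  edge-split : ∀ {x y L} → x ∈ L → y ∈ L → H x y ≡ true → ∃[ L′ ] L ↭ x ∷ y ∷ L′
  edge-split x∈ y∈ xy = distinct-∈⇒↭∷∷ x∈ y∈ (adjacent⇒≢ xy)

  Triangle : V → V → V → Set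
  Triangle x y z = H x y ≡ true × H x z ≡ true × H y z ≡ true

  TriangleFreeOn : List V → Set
  TriangleFreeOn L = ∀ {x y z} → x ∈ L → y ∈ L → z ∈ L → ¬ Triangle x y z

  TriangleFreeOn-⊆ : ∀ {L L′} → (∀ {v} → v ∈ L′ → v ∈ L) → TriangleFreeOn L → TriangleFreeOn L′
  TriangleFreeOn-⊆ L′⊆L tf x∈ y∈ z∈ = tf (L′⊆L x∈) (L′⊆L y∈) (L′⊆L z∈)

  DiamondFree : Set
  DiamondFree = ∀ {x y z v} → Triangle x y z → Triangle x y v → z ≡ v

  triangle-split : ∀ {x y z L} → x ∈ L → y ∈ L → z ∈ L → Triangle x y z →
                   ∃[ L′ ] L ↭ x ∷ y ∷ z ∷ L′
  triangle-split x∈ y∈ z∈ (xy , xz , yz) with L₁ , L↭ ← edge-split x∈ y∈ xy with ∈-resp-↭ L↭ z∈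
  ... | here z≡x = ⊥-elim (adjacent⇒≢ xz (≡.sym z≡x))
  ... | there (here z≡y) = ⊥-elim (adjacent⇒≢ yz (≡.sym z≡y))
  ... | there (there z∈L₁) with L₂ , L₁↭ ← ∈⇒↭∷ z∈L₁ =
    L₂ , ↭-trans L↭ (↭-prep _ (↭-prep _ L₁↭))

  edgesIn-edge : ∀ {x y} L → H x y ≡ true →
                 edgesIn H (x ∷ y ∷ L) ≡ 1 + (degree H x L + degree H y L) + edgesIn H L
  edgesIn-edge {x} {y} L xy =
    ≡.trans (edgesIn-∷∷ H x y L) (cong (λ b → iverson b + (degree H x L + degree H y L) + edgesIn H L) xy)

  edgesIn-triangle : ∀ {x y z} L → Triangle x y z →
    edgesIn H (x ∷ y ∷ z ∷ L) ≡ 3 + (degree H x L + degree H y L + degree H z L) + edgesIn H L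
  edgesIn-triangle {x} {y} {z} L (xy , xz , yz) = begin
    edgesIn H (x ∷ y ∷ z ∷ L)
      ≡⟨ edgesIn-edge (z ∷ L) xy ⟩
    1 + ((iverson (H x z) + dx) + (iverson (H y z) + dy)) + (dz + edgesIn H L)
      ≡⟨ cong₂ (λ a b → 1 + ((iverson a + dx) + (iverson b + dy)) + (dz + edgesIn H L)) xz yz ⟩
    1 + ((1 + dx) + (1 + dy)) + (dz + edgesIn H L)
      ≡⟨ regroup dx dy dz (edgesIn H L) ⟩
    3 + (dx + dy + dz) + edgesIn H L
      ∎
    where
    open ≡.≡-Reasoning
    dx = degree H x L
    dy = degree H y L
    dz = degree H z L
    regroup : ∀ a b c E → 1 + ((1 + a) + (1 + b)) + (c + E) ≡ 3 + (a + b + c) + E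
    regroup = solve-∀

  degrees-≤-length : ∀ {x y} L → (∀ {v} → v ∈ L → H x v ≡ true → H y v ≡ true → ⊥) →
                     degree H x L + degree H y L ≤ length L
  degrees-≤-length {x} {y} L excl =
    subst (_≤ length L) (sum-map-+ (iverson ∘ H x) (iverson ∘ H y) L)
      (sum-map-≤-length L (λ v∈ → iverson-+-≤1 _ _ (excl v∈)))

  degrees-≥-length⇒complementary : ∀ {x y} L → (∀ {v} → v ∈ L → H x v ≡ true → H y v ≡ true → ⊥) →
                                   length L ≤ degree H x L + degree H y L → ∀ {v} → v ∈ L → H y v ≡ not (H x v)
  degrees-≥-length⇒complementary {x} {y} L excl tight v∈ =
    exactly-one _ _ (sum-map-≥-length⇒≡1 L (λ v∈ → iverson-+-≤1 _ _ (excl v∈))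
                      (subst (length L ≤_) (≡.sym (sum-map-+ (iverson ∘ H x) (iverson ∘ H y) L)) tight) v∈)
    where
    exactly-one : ∀ a b → iverson a + iverson b ≡ 1 → b ≡ not a
    exactly-one true  false _ = refl
    exactly-one false true  _ = refl

  flip : ∀ {x y} → H x y ≡ true → H y x ≡ true
  flip {x} {y} xy = ≡.trans (H-sym y x) xy

  diamondFree-degrees : DiamondFree → ∀ {x y z} L → Triangle x y z →
                        All (x ≢_) L → All (y ≢_) L → All (z ≢_) L →
                        degree H x L + degree H y L + degree H z L ≤ length L
  diamondFree-degrees df {x} {y} {z} L (xy , xz , yz) x≢ y≢ z≢ =
    subst (_≤ length L) sums (sum-map-≤-length L (λ v∈ → iverson-+-+-≤1 _ _ _
      (λ xv yv → All.lookup z≢ v∈ (df (xy , xz , yz) (xy , xv , yv)))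
      (λ xv zv → All.lookup y≢ v∈ (df (xz , xy , flip yz) (xz , xv , zv)))
      (λ yv zv → All.lookup x≢ v∈ (df (yz , flip xy , flip xz) (yz , yv , zv)))))
    where
    sums : sum (map (λ v → iverson (H x v) + iverson (H y v) + iverson (H z v)) L) ≡
           degree H x L + degree H y L + degree H z L
    sums = ≡.trans (sum-map-+ (λ v → iverson (H x v) + iverson (H y v)) (iverson ∘ H z) L)
                   (cong (_+ degree H z L) (sum-map-+ (iverson ∘ H x) (iverson ∘ H y) L))

  mantel : ∀ L → TriangleFreeOn L → 4 * edgesIn H L ≤ length L * length L
  mantel L = go L (<-wellFounded (length L))
    where
    go : ∀ L → Acc _<_ (length L) → TriangleFreeOn L → 4 * edgesIn H L ≤ length L * length L
    go L _ tf with edgesIn≡0⊎edge H L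
    go L _ tf | inj₁ E≡0 = subst (λ E → 4 * E ≤ length L * length L) (≡.sym E≡0) z≤n
    go L (acc smaller) tf | inj₂ (x , y , x∈ , y∈ , xy) with L′ , L↭ ← edge-split x∈ y∈ xy =
      subst₂ (λ E n → 4 * E ≤ n * n)
        (≡.sym (≡.trans (edgesIn-↭ L↭) (edgesIn-edge L′ xy))) (≡.sym (↭-length L↭))
        (mantel-step (degrees-≤-length L′ (λ v∈ xv yv → tf x∈ y∈ (sub v∈) (xy , xv , yv)))
                     (go L′ (smaller (<-trans (n<1+n _) (↭∷⇒shorter L↭))) (TriangleFreeOn-⊆ sub tf)))
      where
      sub : ∀ {v} → v ∈ L′ → v ∈ L
      sub = ↭-⊆ L↭ ∘ there ∘ there

  TriangleIn : List V → Set
  TriangleIn L = ∃[ x ] x ∈ L × ∃[ y ] y ∈ L × ∃[ z ] z ∈ L × Triangle x y z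

  triangleIn? : ∀ L → Dec (TriangleIn L)
  triangleIn? L = ∃∈? (λ x → ∃∈? (λ y → ∃∈? (triangle? x y) L) L) L
    where
    triangle? : ∀ x y z → Dec (Triangle x y z)
    triangle? x y z = (H x y ≟ᵇ true) ×-dec (H x z ≟ᵇ true) ×-dec (H y z ≟ᵇ true)

  ¬TriangleIn⇒TriangleFreeOn : ∀ {L} → ¬ TriangleIn L → TriangleFreeOn L
  ¬TriangleIn⇒TriangleFreeOn ¬t x∈ y∈ z∈ t = ¬t (_ , x∈ , _ , y∈ , _ , z∈ , t)

  diamondFree-bound : DiamondFree → ∀ L → Unique L →
                      4 * edgesIn H L ≤ length L * length L ⊎ (length L ≡ 3 × edgesIn H L ≤ 3)
  diamondFree-bound df L = go L (<-wellFounded (length L))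
    where
    go : ∀ L → Acc _<_ (length L) → Unique L →
         4 * edgesIn H L ≤ length L * length L ⊎ (length L ≡ 3 × edgesIn H L ≤ 3)
    go L _ u with triangleIn? L
    go L _ u | no ¬t = inj₁ (mantel L (¬TriangleIn⇒TriangleFreeOn ¬t))
    go L (acc smaller) u | yes (x , x∈ , y , y∈ , z , z∈ , t)
      with L′ , L↭ ← triangle-split x∈ y∈ z∈ t
      with (_ ∷ _ ∷ x≢) ∷ (_ ∷ y≢) ∷ z≢ ∷ u′ ← Unique-resp-↭ L↭ u =
      subst₂ (λ E n → 4 * E ≤ n * n ⊎ (n ≡ 3 × E ≤ 3))
        (≡.sym (≡.trans (edgesIn-↭ L↭) (edgesIn-triangle L′ t))) (≡.sym (↭-length L↭))
        (diamond-step (length L′) (diamondFree-degrees df L′ t x≢ y≢ z≢)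
          (go L′ (smaller (<-trans (≤-trans (n<1+n _) (n≤1+n _)) (↭∷⇒shorter L↭))) u′))

  diamondFree-tight⇒triangleFree : DiamondFree → ∀ L → Unique L → 7 ≤ length L →
                                   length L * length L ≤ 1 + 4 * edgesIn H L → TriangleFreeOn L
  diamondFree-tight⇒triangleFree df L u 7≤n tight {x} {y} {z} x∈ y∈ z∈ t
    with L′ , L↭ ← triangle-split x∈ y∈ z∈ t
    with (_ ∷ _ ∷ x≢) ∷ (_ ∷ y≢) ∷ z≢ ∷ u′ ← Unique-resp-↭ L↭ u = <-irrefl refl (begin-strict
      length L * length L                  ≤⟨ tight ⟩
      1 + 4 * edgesIn H L                  ≡⟨ cong (λ E → 1 + 4 * E) E≡ ⟩
      1 + 4 * (3 + S + edgesIn H L′)       <⟨ n<1+n _ ⟩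
      2 + 4 * (3 + S + edgesIn H L′)       ≤⟨ triangle-excess 4≤m S≤m 4E′≤m² ⟩
      (3 + m) * (3 + m)                    ≡⟨ cong (λ n → n * n) (↭-length L↭) ⟨
      length L * length L                  ∎)
    where
    open ≤-Reasoning
    m = length L′
    S = degree H x L′ + degree H y L′ + degree H z L′
    S≤m : S ≤ m
    S≤m = diamondFree-degrees df L′ t x≢ y≢ z≢
    E≡ : edgesIn H L ≡ 3 + S + edgesIn H L′
    E≡ = ≡.trans (edgesIn-↭ L↭) (edgesIn-triangle L′ t)
    4≤m : 4 ≤ m
    4≤m = +-cancelˡ-≤ 3 4 m (≤-trans 7≤n (≤-reflexive (↭-length L↭)))
    4E′≤m² : 4 * edgesIn H L′ ≤ m * m
    4E′≤m² with diamondFree-bound df L′ u′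
    ... | inj₁ bound = bound
    ... | inj₂ (m≡3 , _) with () ← <-irrefl (≡.sym m≡3) (≤-trans (s≤s ≤-refl) 4≤m)

  CompleteBipartiteOn : (V → Bool) → List V → Set
  CompleteBipartiteOn c L = ∀ {x y} → x ∈ L → y ∈ L → H x y ≡ c x xor c y

  CompleteBipartiteOn-↭ : ∀ {c L L′} → L ↭ L′ → CompleteBipartiteOn c L′ → CompleteBipartiteOn c L
  CompleteBipartiteOn-↭ L↭ cb x∈ y∈ = cb (∈-resp-↭ L↭ x∈) (∈-resp-↭ L↭ y∈)

  CompleteBipartiteOn-∷ : ∀ {c v L} → (∀ {q} → q ∈ v ∷ L → H v q ≡ c v xor c q) →
                          CompleteBipartiteOn c L → CompleteBipartiteOn (c) (v ∷ L)
  CompleteBipartiteOn-∷ row cb (here refl) q∈ = row q∈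
  CompleteBipartiteOn-∷ {c} row cb {p} (there p∈) (here refl) =
    ≡.trans (H-sym p _) (≡.trans (row (there p∈)) (xor-comm (c _) (c p)))
  CompleteBipartiteOn-∷ row cb (there p∈) (there q∈) = cb p∈ q∈

  completeBipartite-unique : ∀ {c d} L → CompleteBipartiteOn c L → CompleteBipartiteOn d L →
                             (∀ {v} → v ∈ L → d v ≡ c v) ⊎ (∀ {v} → v ∈ L → d v ≡ not (c v))
  completeBipartite-unique [] _ _ = inj₁ λ ()
  completeBipartite-unique {c} {d} (p ∷ L) cb cb′ = by-offset (d p xor c p) refl
    where
    offset : ∀ {v} → v ∈ p ∷ L → d v ≡ (d p xor c p) xor c v
    offset v∈ = xor-shift (c p) (c _) (d p) (d _) (≡.trans (≡.sym (cb (here refl) v∈)) (cb′ (here refl) v∈))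
    by-offset : ∀ b → d p xor c p ≡ b →
                (∀ {v} → v ∈ p ∷ L → d v ≡ c v) ⊎ (∀ {v} → v ∈ p ∷ L → d v ≡ not (c v))
    by-offset false eq = inj₁ λ v∈ → ≡.trans (offset v∈) (cong (_xor c _) eq)
    by-offset true  eq = inj₂ λ v∈ → ≡.trans (offset v∈) (cong (_xor c _) eq)

  edgesIn-completeBipartite : ∀ {c} L → CompleteBipartiteOn c L → edgesIn H L ≡ count c L * count (not ∘ c) L
  edgesIn-completeBipartite [] _ = refl
  edgesIn-completeBipartite {c} (x ∷ L) cb =
    ≡.trans (cong₂ _+_ (sum-map-cong-∈ L (λ v∈ → cong iverson (cb (here refl) (there v∈))))
                       (edgesIn-completeBipartite L (λ p∈ q∈ → cb (there p∈) (there q∈))))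
            (split (c x))
    where
    t = count c L
    f = count (not ∘ c) L
    split : ∀ b → count (λ v → b xor c v) L + t * f ≡ (iverson b + t) * (iverson (not b) + f)
    split true = refl
    split false = ≡.sym (*-suc t f)

  completeBipartite-balanced⇒tight : ∀ {c} L → CompleteBipartiteOn c L → Balanced c L →
                                     length L * length L ≤ 1 + 4 * edgesIn H L
  completeBipartite-balanced⇒tight {c} L cb bal =
    ≤-trans (square≤1+4⌊n/2⌋⌈n/2⌉ (length L))
      (≤-reflexive (cong (λ E → 1 + 4 * E) (≡.sym (≡.trans (edgesIn-completeBipartite L cb) (halves bal)))))
    where
    total = count-+-count-not c L
    halves : Balanced c L → count c L * count (not ∘ c) L ≡ ⌊ length L /2⌋ * ⌈ length L /2⌉
    halves (inj₁ t≡) = cong₂ _*_ t≡ (⌊n/2⌋-complement total t≡)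
    halves (inj₂ f≡) = ≡.trans (*-comm (count c L) _)
      (cong₂ _*_ f≡ (⌊n/2⌋-complement (≡.trans (+-comm (count (not ∘ c) L) _) total) f≡))

  tight-edge-removal : ∀ {x y} L → H x y ≡ true → TriangleFreeOn (x ∷ y ∷ L) →
                       (2 + length L) * (2 + length L) ≤ 1 + 4 * edgesIn H (x ∷ y ∷ L) →
                       length L * length L ≤ 1 + 4 * edgesIn H L × (∀ {v} → v ∈ L → H y v ≡ not (H x v))
  tight-edge-removal {x} {y} L xy tf tight = tight′ , degrees-≥-length⇒complementary L excl m≤S
    where
    excl : ∀ {v} → v ∈ L → H x v ≡ true → H y v ≡ true → ⊥
    excl v∈ xv yv = tf (here refl) (there (here refl)) (there (there v∈)) (xy , xv , yv)
    bounds = mantel-step-tight (degrees-≤-length L excl)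
                               (mantel L (TriangleFreeOn-⊆ (there ∘ there) tf))
                               (≤-trans tight (≤-reflexive (cong (λ E → 1 + 4 * E) (edgesIn-edge L xy))))
    m≤S = proj₁ bounds
    tight′ = proj₂ bounds

  extend-bipartition : ∀ {x y c} L → H x y ≡ true → TriangleFreeOn (x ∷ y ∷ L) →
                       (∀ {v} → v ∈ L → H y v ≡ not (H x v)) →
                       CompleteBipartiteOn c L → Balanced c L →
                       CompleteBipartiteOn (H x) (x ∷ y ∷ L) × Balanced (H x) (x ∷ y ∷ L)
  extend-bipartition {x} {y} {c} L xy tf y≡¬x cb bal =
    CompleteBipartiteOn-∷ {H x} {x} {y ∷ L} x-row (CompleteBipartiteOn-∷ {H x} {y} {L} y-row sides) ,
    Balanced-∷∷ {c = H x} {x} {y} {L} (≡.trans xy (cong not (≡.sym (H-irrefl x))))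
      ([ (λ Hx≡c → Balanced-cong (λ v∈ → Hx≡c v∈) bal)
       , (λ Hx≡¬c → Balanced-cong (λ v∈ → Hx≡¬c v∈) (Balanced-not {c = c} {L} bal))
       ]′ (completeBipartite-unique L cb sides))
    where
    in-L : ∀ {v} → v ∈ L → v ∈ x ∷ y ∷ L
    in-L = there ∘ there
    y-adj : ∀ {v} → v ∈ L → H x v ≡ false → H y v ≡ true
    y-adj v∈ xv = ≡.trans (y≡¬x v∈) (cong not xv)
    -- Were p and q non-adjacent, they would lie on one side of c, and a vertex u on the other
    -- side would be a common neighbour of them, closing a triangle with x or with y.
    mixed : ∀ {p q} → p ∈ L → q ∈ L → H x p ≡ true → H x q ≡ false → H p q ≡ true
    mixed {p} {q} p∈ q∈ xp xq = ¬-not λ pq →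
      let u , u∈ , cu = Balanced⇒both-colours (distinct-∈⇒2≤length p∈ q∈ p≢q) bal (not (c p))
      in no-common-neighbour u∈ (across u∈ p∈ cu refl)
                                (across u∈ q∈ cu (xor≡false⇒≡ (c p) (c q) (≡.trans (≡.sym (cb p∈ q∈)) pq)))
      where
      p≢q : p ≢ q
      p≢q refl with () ← ≡.trans (≡.sym xp) xq
      across : ∀ {u v} → u ∈ L → v ∈ L → c u ≡ not (c p) → c v ≡ c p → H u v ≡ true
      across u∈ v∈ cu cv = ≡.trans (cb u∈ v∈) (≡.trans (cong₂ _xor_ cu cv) (not-xor-self (c p)))
      no-common-neighbour : ∀ {u} → u ∈ L → H u p ≡ true → H u q ≡ true → ⊥
      no-common-neighbour {u} u∈ up uq with H x u in xu
      ... | true  = tf (here refl) (in-L p∈) (in-L u∈) (xp , xu , flip up)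
      ... | false = tf (there (here refl)) (in-L q∈) (in-L u∈) (y-adj q∈ xq , y-adj u∈ xu , flip uq)
    sides : CompleteBipartiteOn (H x) L
    sides {p} {q} p∈ q∈ with H x p in xp | H x q in xq
    ... | true  | true  = ¬-not λ pq → tf (here refl) (in-L p∈) (in-L q∈) (xp , xq , pq)
    ... | false | false =
      ¬-not λ pq → tf (there (here refl)) (in-L p∈) (in-L q∈) (y-adj p∈ xp , y-adj q∈ xq , pq)
    ... | true  | false = mixed p∈ q∈ xp xq
    ... | false | true  = ≡.trans (H-sym p q) (mixed q∈ p∈ xq xp)
    x-row : ∀ {q} → q ∈ x ∷ y ∷ L → H x q ≡ H x x xor H x q
    x-row {q} _ = cong (_xor H x q) (≡.sym (H-irrefl x))
    y-row : ∀ {q} → q ∈ y ∷ L → H y q ≡ H x y xor H x q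
    y-row (here refl) = ≡.trans (H-irrefl y) (≡.sym (xor-same (H x y)))
    y-row {q} (there q∈) = ≡.trans (y≡¬x q∈) (cong (_xor H x q) (≡.sym xy))

  mantel-stability : ∀ L → TriangleFreeOn L → length L * length L ≤ 1 + 4 * edgesIn H L →
                     ∃[ c ] CompleteBipartiteOn c L × Balanced c L
  mantel-stability L = go L (<-wellFounded (length L))
    where
    go : ∀ L → Acc _<_ (length L) → TriangleFreeOn L → length L * length L ≤ 1 + 4 * edgesIn H L →
         ∃[ c ] CompleteBipartiteOn c L × Balanced c L
    go L _ tf tight with edgesIn≡0⊎edge H L
    go [] _ _ _ | inj₁ _ = (λ _ → false) , (λ ()) , inj₁ refl
    go (a ∷ []) _ _ _ | inj₁ _ = (λ _ → false) , (λ { (here refl) (here refl) → H-irrefl a }) , inj₁ refl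
    go (a ∷ b ∷ L) _ _ tight | inj₁ E≡0
      with s≤s () ← ≤-trans tight (≤-reflexive (cong (λ E → 1 + 4 * E) E≡0))
    go L (acc smaller) tf tight | inj₂ (x , y , x∈ , y∈ , xy)
      with L′ , L↭ ← edge-split x∈ y∈ xy
      with tf′ ← TriangleFreeOn-⊆ (↭-⊆ L↭) tf
      with tight′ , y≡¬x ← tight-edge-removal L′ xy tf′
                             (subst₂ (λ n E → n * n ≤ 1 + 4 * E) (↭-length L↭) (edgesIn-↭ L↭) tight)
      with c′ , cb′ , bal′ ← go L′ (smaller (<-trans (n<1+n _) (↭∷⇒shorter L↭)))
                                (TriangleFreeOn-⊆ (there ∘ there) tf′) tight′
      with cb , bal ← extend-bipartition L′ xy tf′ y≡¬x cb′ bal′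
      = H x , CompleteBipartiteOn-↭ {H x} L↭ cb , Balanced-↭ L↭ bal

length-allFin : ∀ n → length (allFin n) ≡ n
length-allFin n = length-tabulate {n = n} (λ i → i)

sum-map-tabulate : ∀ {A : Set} {n} (f : A → ℕ) (g : Fin n → A) →
                   sum (map f (tabulate g)) ≡ sum (tabulate (f ∘ g))
sum-map-tabulate f g = cong sum (map-tabulate g f)

countEdges≡edgesIn : ∀ m (a : Fin m → Fin m → Bool) → countEdges m a ≡ edgesIn a (allFin m)
countEdges≡edgesIn zero a = refl
countEdges≡edgesIn (suc m) a = cong₂ _+_ first-row later-rows
  where
  open ≡.≡-Reasoning
  row : ∀ {k} → (Fin k → Fin k → Bool) → Fin k → ℕ
  row {k} b i = sum (map (λ j → iverson ((toℕ i <ᵇ toℕ j) ∧ b i j)) (allFin k))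
  a′ : Fin m → Fin m → Bool
  a′ i j = a (suc i) (suc j)
  first-row : row a zero ≡ degree a zero (tabulate suc)
  first-row = ≡.trans (sum-map-tabulate (λ j → iverson ((0 <ᵇ toℕ j) ∧ a zero j)) suc)
                      (≡.sym (sum-map-tabulate (iverson ∘ a zero) suc))
  row-suc : ∀ i → row a (suc i) ≡ row a′ i
  row-suc i = ≡.trans (sum-map-tabulate (λ j → iverson ((toℕ (suc i) <ᵇ toℕ j) ∧ a (suc i) j)) suc)
                      (≡.sym (sum-map-tabulate (λ j → iverson ((toℕ i <ᵇ toℕ j) ∧ a′ i j)) (λ j → j)))
  later-rows : sum (map (row a) (tabulate suc)) ≡ edgesIn a (tabulate suc)
  later-rows = begin
    sum (map (row a) (tabulate suc))     ≡⟨ sum-map-tabulate (row a) suc ⟩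
    sum (tabulate (row a ∘ suc))         ≡⟨ cong sum (tabulate-cong row-suc) ⟩
    sum (tabulate (row a′))              ≡⟨ sum-map-tabulate (row a′) (λ i → i) ⟨
    countEdges m a′                      ≡⟨ countEdges≡edgesIn m a′ ⟩
    edgesIn a′ (allFin m)                ≡⟨ edgesIn-map a suc (allFin m) ⟨
    edgesIn a (map suc (allFin m))       ≡⟨ cong (edgesIn a) (map-tabulate (λ i → i) suc) ⟩
    edgesIn a (tabulate suc)             ∎

⌊≟⌋-refl : ∀ {n} (i : Fin n) → ⌊ i ≟ i ⌋ ≡ true
⌊≟⌋-refl i = ≡.trans (isYes≗does (i ≟ i)) (dec-true (i ≟ i) refl)

⌊≟⌋-≢ : ∀ {n} {i j : Fin n} → i ≢ j → ⌊ i ≟ j ⌋ ≡ false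
⌊≟⌋-≢ {i = i} {j} i≢j = ≡.trans (isYes≗does (i ≟ j)) (dec-false (i ≟ j) i≢j)

⌊≟⌋-sym : ∀ {n} (i j : Fin n) → ⌊ i ≟ j ⌋ ≡ ⌊ j ≟ i ⌋
⌊≟⌋-sym i j with i ≟ j
... | yes refl = ≡.sym (⌊≟⌋-refl i)
... | no i≢j   = ≡.sym (⌊≟⌋-≢ (i≢j ∘ ≡.sym))

complement : ∀ {n} → Graph n → Graph n
complement G = record
  { adj    = λ i j → not (adj G i j) ∧ not ⌊ i ≟ j ⌋
  ; irrefl = λ i → ≡.trans (cong (λ b → not b ∧ not ⌊ i ≟ i ⌋) (irrefl G i)) (cong not (⌊≟⌋-refl i))
  ; sym    = λ i j → cong₂ (λ a b → not a ∧ not b) (sym G i j) (⌊≟⌋-sym i j)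
  }

complement-adj : ∀ {n} (G : Graph n) {i j} → i ≢ j → adj (complement G) i j ≡ not (adj G i j)
complement-adj G {i} {j} i≢j = ≡.trans (cong (λ b → not (adj G i j) ∧ not b) (⌊≟⌋-≢ i≢j)) (∧-identityʳ _)

complement-adjacent : ∀ {n} (G : Graph n) {i j} → adj (complement G) i j ≡ true → adj G i j ≡ false
complement-adjacent G {i} {j} ij with adj G i j in eq
... | false = refl
... | true with () ← ij

e+e[complement]≡nC2 : ∀ {n} (G : Graph n) → e G + e (complement G) ≡ n C 2
e+e[complement]≡nC2 {n} G = begin
  e G + e (complement G)
    ≡⟨ cong₂ _+_ (countEdges≡edgesIn n (adj G)) (countEdges≡edgesIn n (adj (complement G))) ⟩
  edgesIn (adj G) (allFin n) + edgesIn (adj (complement G)) (allFin n)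
    ≡⟨ edgesIn-complementary (adj G) (adj (complement G)) (allFin n) (allFin⁺ n) (complement-adj G) ⟩
  length (allFin n) C 2
    ≡⟨ cong (_C 2) (length-allFin n) ⟩
  n C 2
    ∎
  where open ≡.≡-Reasoning

countEdges4≤1 : ∀ (a : Fin 4 → Fin 4 → Bool) →
  a zero (suc zero) ≡ false → a zero (suc (suc zero)) ≡ false → a zero (suc (suc (suc zero))) ≡ false →
  a (suc zero) (suc (suc zero)) ≡ false → a (suc zero) (suc (suc (suc zero))) ≡ false →
  countEdges 4 a ≤ 1
countEdges4≤1 a a01 a02 a03 a12 a13 rewrite a01 | a02 | a03 | a12 | a13 =
  ≤-trans (≤-reflexive (≡.trans (+-identityʳ _) (+-identityʳ _)))
          (iverson-≤1 (a (suc (suc zero)) (suc (suc (suc zero)))))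

module OfGraph {n} (G : Graph n) = SimpleGraph (adj G) (sym G) (irrefl G)

[4,2]⇒complement-diamondFree : ∀ {n} (G : Graph n) → IsSTGraph 4 2 G → OfGraph.DiamondFree (complement G)
[4,2]⇒complement-diamondFree {n} G (_ , dense) {x} {y} {z} {v} (xy , xz , yz) (_ , xv , yv) with z ≟ v
... | yes z≡v = z≡v
... | no z≢v = ⊥-elim (<-irrefl refl (≤-trans (dense (Vec.lookup quadruple) (lookup-injective distinct))
                                               (countEdges4≤1 induced (non xy) (non xz) (non xv) (non yz) (non yv))))
  where
  open OfGraph (complement G) using (adjacent⇒≢)
  non : ∀ {i j} → adj (complement G) i j ≡ true → adj G i j ≡ false
  non = complement-adjacent G
  quadruple : Vec.Vec (Fin n) 4
  quadruple = x Vec.∷ y Vec.∷ z Vec.∷ v Vec.∷ Vec.[]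
  distinct : UniqueVec.Unique quadruple
  distinct = (adjacent⇒≢ xy AllVec.∷ adjacent⇒≢ xz AllVec.∷ adjacent⇒≢ xv AllVec.∷ AllVec.[])
      AllPairsVec.∷ (adjacent⇒≢ yz AllVec.∷ adjacent⇒≢ yv AllVec.∷ AllVec.[])
      AllPairsVec.∷ (z≢v AllVec.∷ AllVec.[]) AllPairsVec.∷ AllVec.[] AllPairsVec.∷ AllPairsVec.[]
  induced : Fin 4 → Fin 4 → Bool
  induced i j = adj G (Vec.lookup quadruple i) (Vec.lookup quadruple j)

[4,2]⇒complement-sparse : ∀ {n} (G : Graph n) → IsSTGraph 4 2 G → 4 * e (complement G) ≤ n * n
[4,2]⇒complement-sparse {n} G G∈[4,2]
  with OfGraph.diamondFree-bound (complement G) ([4,2]⇒complement-diamondFree G G∈[4,2])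
                                 (allFin n) (allFin⁺ n)
... | inj₁ bound = subst₂ (λ E m → 4 * E ≤ m * m) (≡.sym (countEdges≡edgesIn n _)) (length-allFin n) bound
... | inj₂ (n≡3 , _) with s≤s (s≤s (s≤s ())) ←
  ≤-trans (proj₁ G∈[4,2]) (≤-reflexive (≡.trans (≡.sym (length-allFin n)) n≡3))

-- Isomorphism with K⌊n/2⌋ + K⌈n/2⌉

sum-tabulate : ∀ {n} (f : Fin n → ℕ) → sum (tabulate f) ≡ Σℕ.sum f
sum-tabulate {zero} f = refl
sum-tabulate {suc n} f = cong (f zero +_) (sum-tabulate (f ∘ suc))

count-allFin : ∀ {n} (p : Fin n → Bool) → count p (allFin n) ≡ Σℕ.sum (iverson ∘ p)
count-allFin p = ≡.trans (sum-map-tabulate (iverson ∘ p) (λ i → i)) (sum-tabulate (iverson ∘ p))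

count-allFin-suc : ∀ {n} (p : Fin (suc n) → Bool) →
                   count p (allFin (suc n)) ≡ iverson (p zero) + count (p ∘ suc) (allFin n)
count-allFin-suc p = cong (iverson (p zero) +_)
  (≡.trans (sum-map-tabulate (iverson ∘ p) suc) (≡.sym (sum-map-tabulate (iverson ∘ p ∘ suc) (λ i → i))))

count-permute : ∀ {n} (p : Fin n → Bool) (σ : Permutation′ n) →
                count (p ∘ (σ ⟨$⟩ʳ_)) (allFin n) ≡ count p (allFin n)
count-permute p σ = ≡.trans (count-allFin (p ∘ (σ ⟨$⟩ʳ_)))
                            (≡.trans (≡.sym (Σℕ.sum-permute (iverson ∘ p) σ)) (≡.sym (count-allFin p)))

count-<ᵇ : ∀ {n h} → h ≤ n → count (λ (v : Fin n) → toℕ v <ᵇ h) (allFin n) ≡ h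
count-<ᵇ {zero} z≤n = refl
count-<ᵇ {suc n} {zero} z≤n = ≡.trans (count-allFin-suc {n} (λ v → toℕ v <ᵇ 0)) (count-<ᵇ {n} z≤n)
count-<ᵇ {suc n} {suc h} (s≤s h≤n) =
  ≡.trans (count-allFin-suc {n} (λ v → toℕ v <ᵇ suc h)) (cong suc (count-<ᵇ {n} h≤n))

n<ᵇn≡false : ∀ n → (n <ᵇ n) ≡ false
n<ᵇn≡false zero = refl
n<ᵇn≡false (suc n) = n<ᵇn≡false n

punchIn-<ᵇ : ∀ {n} (p : Fin (suc n)) (j : Fin n) → (toℕ (punchIn p j) <ᵇ toℕ p) ≡ (toℕ j <ᵇ toℕ p)
punchIn-<ᵇ zero j = refl
punchIn-<ᵇ (suc p) zero = refl
punchIn-<ᵇ (suc p) (suc j) = punchIn-<ᵇ p j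

count-allFin-≤ : ∀ {n} (p : Fin n → Bool) → count p (allFin n) ≤ n
count-allFin-≤ {n} p = ≤-trans (count≤length p (allFin n)) (≤-reflexive (length-allFin n))

_sorts_below_ : ∀ {n} → Permutation′ n → (Fin n → Bool) → ℕ → Set
σ sorts d below k = ∀ v → (toℕ (σ ⟨$⟩ʳ v) <ᵇ k) ≡ d v

-- Vertex 0 is sent to 0 if d 0 holds, and otherwise to the first place after the block of d-vertices.
colour-sorting : ∀ {n} (d : Fin n → Bool) → Σ[ σ ∈ Permutation′ n ] σ sorts d below count d (allFin n)
colour-sorting {zero} d = Permutation.id , λ ()
colour-sorting {suc n} d = place (d zero) refl
  where
  σ′ = proj₁ (colour-sorting (d ∘ suc))
  sorted′ = proj₂ (colour-sorting (d ∘ suc))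
  k′ = count (d ∘ suc) (allFin n)
  count≡ : ∀ {b} → d zero ≡ b → count d (allFin (suc n)) ≡ iverson b + k′
  count≡ d₀ = ≡.trans (count-allFin-suc d) (cong (λ b → iverson b + k′) d₀)
  place : ∀ b → d zero ≡ b → Σ[ σ ∈ Permutation′ (suc n) ] σ sorts d below count d (allFin (suc n))
  place true d₀ = Permutation.lift₀ σ′ , sorted
    where
    sorted : Permutation.lift₀ σ′ sorts d below count d (allFin (suc n))
    sorted zero    rewrite count≡ d₀ = ≡.sym d₀
    sorted (suc w) rewrite count≡ d₀ = sorted′ w
  place false d₀ = Permutation.insert zero p σ′ , sorted
    where
    k′<1+n : k′ < suc n
    k′<1+n = s≤s (count-allFin-≤ (d ∘ suc))
    p : Fin (suc n)
    p = fromℕ< k′<1+n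
    sorted : Permutation.insert zero p σ′ sorts d below count d (allFin (suc n))
    sorted zero rewrite count≡ d₀ =
      ≡.trans (cong (_<ᵇ k′) (toℕ-fromℕ< k′<1+n)) (≡.trans (n<ᵇn≡false k′) (≡.sym d₀))
    sorted (suc w) rewrite count≡ d₀ = begin
      (toℕ (Permutation.insert zero p σ′ ⟨$⟩ʳ suc w) <ᵇ k′)
        ≡⟨ cong (λ i → toℕ i <ᵇ k′) (Permutation.insert-punchIn zero p σ′ w) ⟩
      (toℕ (punchIn p (σ′ ⟨$⟩ʳ w)) <ᵇ k′)
        ≡⟨ cong (toℕ (punchIn p (σ′ ⟨$⟩ʳ w)) <ᵇ_) (toℕ-fromℕ< k′<1+n) ⟨
      (toℕ (punchIn p (σ′ ⟨$⟩ʳ w)) <ᵇ toℕ p)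
        ≡⟨ punchIn-<ᵇ p (σ′ ⟨$⟩ʳ w) ⟩
      (toℕ (σ′ ⟨$⟩ʳ w) <ᵇ toℕ p)
        ≡⟨ cong (toℕ (σ′ ⟨$⟩ʳ w) <ᵇ_) (toℕ-fromℕ< k′<1+n) ⟩
      (toℕ (σ′ ⟨$⟩ʳ w) <ᵇ k′)
        ≡⟨ sorted′ w ⟩
      d (suc w)
        ∎
      where open ≡.≡-Reasoning

module _ {n} (G : Graph n) where

  open OfGraph (complement G) using (CompleteBipartiteOn)

  IsomorphismToTwoCliques : Permutation′ n → Set
  IsomorphismToTwoCliques σ = ∀ i j → adj G i j ≡ twoCliquesAdj n (σ ⟨$⟩ʳ i) (σ ⟨$⟩ʳ j)

  ComplementBipartiteBy : (Fin n → Bool) → Set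
  ComplementBipartiteBy c = ∀ i j → adj (complement G) i j ≡ c i xor c j

  module _ (σ : Permutation′ n) (c : Fin n → Bool) (sorted : σ sorts c below ⌊ n /2⌋) where

    twoCliquesAdj-sorted : ∀ {i j} → i ≢ j → twoCliquesAdj n (σ ⟨$⟩ʳ i) (σ ⟨$⟩ʳ j) ≡ not (c i xor c j)
    twoCliquesAdj-sorted {i} {j} i≢j = begin
      not ⌊ σ ⟨$⟩ʳ i ≟ σ ⟨$⟩ʳ j ⌋ ∧ ⌊ half (σ ⟨$⟩ʳ i) ≟ᵇ half (σ ⟨$⟩ʳ j) ⌋
        ≡⟨ cong (λ b → not b ∧ ⌊ half (σ ⟨$⟩ʳ i) ≟ᵇ half (σ ⟨$⟩ʳ j) ⌋) (⌊≟⌋-≢ (i≢j ∘ σ-injective)) ⟩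
      ⌊ half (σ ⟨$⟩ʳ i) ≟ᵇ half (σ ⟨$⟩ʳ j) ⌋
        ≡⟨ cong₂ (λ a b → ⌊ a ≟ᵇ b ⌋) (sorted i) (sorted j) ⟩
      ⌊ c i ≟ᵇ c j ⌋
        ≡⟨ ⌊≟ᵇ⌋≡not-xor (c i) (c j) ⟩
      not (c i xor c j)
        ∎
      where
      open ≡.≡-Reasoning
      half : Fin n → Bool
      half v = toℕ v <ᵇ ⌊ n /2⌋
      σ-injective : σ ⟨$⟩ʳ i ≡ σ ⟨$⟩ʳ j → i ≡ j
      σ-injective = Injection.injective (↔⇒↣ σ)

    isomorphism⇔complement-bipartite : IsomorphismToTwoCliques σ ⇔ ComplementBipartiteBy c
    isomorphism⇔complement-bipartite = mk⇔ to from
      where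
      to : IsomorphismToTwoCliques σ → ComplementBipartiteBy c
      to iso i j = by-cases (i ≟ j)
        where
        by-cases : Dec (i ≡ j) → adj (complement G) i j ≡ c i xor c j
        by-cases (yes refl) = ≡.trans (irrefl (complement G) i) (≡.sym (xor-same (c i)))
        by-cases (no i≢j) = begin
          adj (complement G) i j   ≡⟨ complement-adj G i≢j ⟩
          not (adj G i j)          ≡⟨ cong not (≡.trans (iso i j) (twoCliquesAdj-sorted i≢j)) ⟩
          not (not (c i xor c j))  ≡⟨ not-involutive _ ⟩
          c i xor c j              ∎
          where open ≡.≡-Reasoning
      from : ComplementBipartiteBy c → IsomorphismToTwoCliques σ
      from cb i j = by-cases (i ≟ j)
        where
        by-cases : Dec (i ≡ j) → adj G i j ≡ twoCliquesAdj n (σ ⟨$⟩ʳ i) (σ ⟨$⟩ʳ j)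
        by-cases (yes refl) = ≡.trans (irrefl G i) (≡.sym (irrefl (twoCliques n) (σ ⟨$⟩ʳ i)))
        by-cases (no i≢j) = begin
          adj G i j                              ≡⟨ not-involutive _ ⟨
          not (not (adj G i j))                  ≡⟨ cong not (≡.trans (≡.sym (complement-adj G i≢j)) (cb i j)) ⟩
          not (c i xor c j)                      ≡⟨ twoCliquesAdj-sorted i≢j ⟨
          twoCliquesAdj n (σ ⟨$⟩ʳ i) (σ ⟨$⟩ʳ j)  ∎
          where open ≡.≡-Reasoning

  bipartition-with-⌊n/2⌋-side :
    ∀ {c} → CompleteBipartiteOn c (allFin n) → Balanced c (allFin n) →
    ∃[ c′ ] ComplementBipartiteBy c′ × count c′ (allFin n) ≡ ⌊ n /2⌋
  bipartition-with-⌊n/2⌋-side {c} cb (inj₁ t≡) =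
    c , (λ i j → cb (∈-allFin i) (∈-allFin j)) , ≡.trans t≡ (cong ⌊_/2⌋ (length-allFin n))
  bipartition-with-⌊n/2⌋-side {c} cb (inj₂ f≡) =
    not ∘ c , (λ i j → ≡.trans (cb (∈-allFin i) (∈-allFin j)) (≡.sym (not-xor-not (c i) (c j)))) ,
    ≡.trans f≡ (cong ⌊_/2⌋ (length-allFin n))

  ≅twoCliques⇔complement-balanced-bipartite :
    G ≅ twoCliques n ⇔ (∃[ c ] CompleteBipartiteOn c (allFin n) × Balanced c (allFin n))
  ≅twoCliques⇔complement-balanced-bipartite = mk⇔ to from
    where
    to : G ≅ twoCliques n → ∃[ c ] CompleteBipartiteOn c (allFin n) × Balanced c (allFin n)
    to (σ , iso) =
      c , (λ {i} {j} _ _ → Equivalence.to (isomorphism⇔complement-bipartite σ c (λ _ → refl)) iso i j) ,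
      inj₁ (≡.trans (count-permute (λ w → toℕ w <ᵇ ⌊ n /2⌋) σ)
             (≡.trans (count-<ᵇ (⌊n/2⌋≤n n)) (cong ⌊_/2⌋ (≡.sym (length-allFin n)))))
      where
      c : Fin n → Bool
      c v = toℕ (σ ⟨$⟩ʳ v) <ᵇ ⌊ n /2⌋
    from : ∃[ c ] CompleteBipartiteOn c (allFin n) × Balanced c (allFin n) → G ≅ twoCliques n
    from (c , cb , bal) with c′ , cb′ , count≡ ← bipartition-with-⌊n/2⌋-side cb bal
                        with σ , sorted ← colour-sorting c′ =
      σ , Equivalence.from (isomorphism⇔complement-bipartite σ c′
            (λ v → ≡.trans (cong (toℕ (σ ⟨$⟩ʳ v) <ᵇ_) (≡.sym count≡)) (sorted v))) cb′

[4,2]⇒complement-tight⇔≅twoCliques : ∀ {n} (G : Graph n) → IsSTGraph 4 2 G → 7 ≤ n →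
                                      (n * n ≤ 1 + 4 * e (complement G)) ⇔ (G ≅ twoCliques n)
[4,2]⇒complement-tight⇔≅twoCliques {n} G G∈[4,2] 7≤n =
  ⇔-trans (mk⇔ tight⇒bipartite bipartite⇒tight) (⇔-sym (≅twoCliques⇔complement-balanced-bipartite G))
  where
  open OfGraph (complement G)
  V = allFin n
  Tight : Set
  Tight = length V * length V ≤ 1 + 4 * edgesIn (adj (complement G)) V
  Tight≡ : (n * n ≤ 1 + 4 * e (complement G)) ≡ Tight
  Tight≡ = cong₂ (λ m E → m * m ≤ 1 + 4 * E) (≡.sym (length-allFin n)) (countEdges≡edgesIn n _)
  tight⇒bipartite : n * n ≤ 1 + 4 * e (complement G) → ∃[ c ] CompleteBipartiteOn c V × Balanced c V
  tight⇒bipartite tight = mantel-stability V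
    (diamondFree-tight⇒triangleFree ([4,2]⇒complement-diamondFree G G∈[4,2]) V (allFin⁺ n)
      (subst (7 ≤_) (≡.sym (length-allFin n)) 7≤n) (subst id Tight≡ tight))
    (subst id Tight≡ tight)
  bipartite⇒tight : ∃[ c ] CompleteBipartiteOn c V × Balanced c V → n * n ≤ 1 + 4 * e (complement G)
  bipartite⇒tight (c , cb , bal) = subst id (≡.sym Tight≡) (completeBipartite-balanced⇒tight V cb bal)

theorem9 : ∀ {n} (G : Graph n) → IsSTGraph 4 2 G →
    ((n ∸ 1) ^ 2 / 4 ≤ e G) ×
    (7 ≤ n → ((e G ≡ (n ∸ 1) ^ 2 / 4) ⇔ (G ≅ twoCliques n)))
theorem9 {zero} G (() , _)
theorem9 {suc k} G G∈[4,2] =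
  X/4≤E , λ 7≤n → ⇔-trans E≡X/4⇔Y≤1+4N ([4,2]⇒complement-tight⇔≅twoCliques G G∈[4,2] 7≤n)
  where
  total : 4 * e G + 4 * e (complement G) + 1 ≡ suc k * suc k + k ^ 2
  total = ≡.trans (cong (_+ 1) (≡.sym (*-distribˡ-+ 4 (e G) _)))
                  (≡.trans (cong (λ E → 4 * E + 1) (e+e[complement]≡nC2 G)) (four-pairs k))
  open QuarterFloor (e G) (e (complement G)) (k ^ 2) (suc k * suc k) total
                    ([4,2]⇒complement-sparse G G∈[4,2])
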